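{- (Substitution Lemma II; provable in $S^2_2$.) Let $U,V$ be (large) integers. Let $\sigma$ be a computation whose conclusions are $\langle t_1,[u/x]\rho\rangle\downarrow v_1,\dots,\langle t_n,[u/x]\rho\rangle\downarrow v_n,\bar\alpha$. Assume $|||\sigma|||\le U-\|t_1[u/x]\|-\cdots-\|t_n[u/x]\|$ and $M(\sigma)\le V$. Then there is a computation $\tau$ deriving $\langle t_i[u/x],\rho\rangle\downarrow v_i$ for $i=1,\dots,n$ and $\bar\alpha$, such that $|||\tau|||\le|||\sigma|||+\|t_1[u/x]\|+\cdots+\|t_n[u/x]\|$ and $M(\tau)\le M(\sigma)\cdot\|u\|$. Moreover, $\tau$ derives $\bar\alpha$ using the same premises and inference rules as $\sigma$.
   Context: For a syntactic object $a$, $\|a\|$ is its number of symbols; for a sequence/DAG, $|||a|||$ is its number of nodes. Approximate terms: terms of $\mathrm{PV}$ (constant $\epsilon$, successors $s_0,s_1$, function symbols for Cobham-derived functions: $\epsilon^n$, $\mathrm{proj}^i_n$, composition, recursion on notation) plus a new constant $*$. A g-numeral is an approximate term built from $\epsilon,s_0,s_1,*$. $r\preceq *$ for all $r$, $r\preceq r$, and $f(\bar r)\preceq f(\bar t)$ when $r_i\preceq t_i$ for all $i$; if $s\preceq t$, $t$ approximates $s$. A development is a sequence of substitutions $[t_1/x_1]\cdots[t_n/x_n]$, $x_i$ distinct, $x_i\notin FV(t_i)$ ($t_i$ possibly open); $()$ is the empty one; $[u/x]\rho$ is the development obtained by prefixing $[u/x]$. Computation statements $\langle t,\rho\rangle\downarrow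 v$ (main term $t$, environment $\rho$, g-numeral value $v$) are derived by the rules (with $X$ the set of argument indices $i$ whose argument $t_i$ is not a g-numeral, $v_i:=t_i$ for $i\notin X$): (Subst) $\langle t,\rho_2\rangle\downarrow v\Rightarrow\langle x,\rho_1[t/x]\rho_2\rangle\downarrow v$, $\rho_1$ without substitution for $x$; ($*$) $\langle t,\rho\rangle\downarrow *$; ($\epsilon n$) $\langle\epsilon,()\rangle\downarrow\epsilon$; ($\epsilon$) $\langle\epsilon,()\rangle\downarrow\epsilon\Rightarrow\langle\epsilon,\rho\rangle\downarrow\epsilon$ for $\rho\neq()$; ($s_i$) $\langle s_iv^*,()\rangle\downarrow s_iv^*,\ \langle t,\rho\rangle\downarrow v\Rightarrow\langle s_it,\rho\rangle\downarrow s_iv^*$ with $v^*$ an approximation of $v$ and ($t\not\equiv v^*$ or $\rho\ne()$); ($s_in$) $\langle v,()\rangle\downarrow v\Rightarrow\langle s_iv,()\rangle\downarrow s_iv$ for g-numeral $v$; ($\epsilon^m$) $\langle\epsilon,()\rangle\downarrow\epsilon,(\langle t_i,\rho\rangle\downarrow v_i)_{i\in X}\Rightarrow\langle\epsilon^m(\bar t),\rho\rangle\downarrow\epsilon$; ($\mathrm{proj}^i_m$) $\langle v_i^*,()\rangle\downarrow v_i^*,(\langle t_j,\rho\rangle\downarrow v_j)_{j\in X}\Rightarrow\langle\mathrm{proj}^i_m(\bar t),\rho\rangle\downarrow v_i^*$, $v_i^*$ approximating $v_i$; (comp) for $f=g(h^1,\dots,h^m)$: $\langle g(\bar w^*),()\rangle\downarrow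 z$, $\langle h^j(\bar v^j),()\rangle\downarrow w_j$, $(\langle t_i,\rho\rangle\downarrow v_i)_{i\in X}\Rightarrow\langle f(\bar t),\rho\rangle\downarrow z$ ($\bar v^j$ approximating $\bar v$, $\bar w^*$ approximating $\bar w$); (rec-$\epsilon$) for $f$ defined by recursion on notation from $g_\epsilon,g_0,g_1$: $\langle g_\epsilon(\bar v^1),()\rangle\downarrow z$, [$\langle t,\rho\rangle\downarrow\epsilon$ if $t$ is not a g-numeral], $(\langle t_j,\rho\rangle\downarrow v_j)_{j\in X}\Rightarrow\langle f(t,\bar t),\rho\rangle\downarrow z$; (rec-$s_i$) $\langle g_i(v^1_0,w^1,\bar v^1),()\rangle\downarrow z$, [$\langle t,\rho\rangle\downarrow s_iv_0$ if $t$ is not a g-numeral], $\langle f(v^2_0,\bar v^2),()\rangle\downarrow w$, $(\langle t_j,\rho\rangle\downarrow v_j)_{j\in X}\Rightarrow\langle f(t,\bar t),\rho\rangle\downarrow z$ (superscripted values approximating the corresponding $v_0,\bar v,w$). A computation is a finite sequence of statements, each obtained by one rule from earlier entries (viewed as a DAG); its conclusions are the statements not used as premises, and "$\tau$ derives $\bar\beta$" means $\bar\beta$ are among/are its conclusions. $M(\sigma)$ is the maximum of $\|t\|$ over main terms $t$ of statements in $\sigma$. -}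

module Defs where

open import Data.Nat using (ℕ; zero; suc; _+_; _*_; _≤_; _<_; _⊔_; _≡ᵇ_)
open import Data.Bool using (Bool; true; false; if_then_else_; _∨_)
open import Data.Fin using (Fin; toℕ)
open import Data.Vec using (Vec; []; _∷_)
open import Data.List using (List; []; _∷_; _++_; map; length; lookup; foldr)
open import Data.List.Relation.Unary.All using (All)
open import Data.List.Relation.Unary.Unique.Propositional using (Unique)
open import Data.List.Membership.Propositional using (_∈_)
open import Data.Maybe using (Maybe; just; nothing)
open import Data.Product using (Σ; ∃; _×_; _,_; proj₁; proj₂)
open import Data.Sum using (_⊎_)
open import Relation.Binary.PropositionalEquality using (_≡_; _≢_)
open import Relation.Nullary using (¬_)

-- Function symbols of PV (Cobham-derived functions), indexed by arity.
-- The successors s₀, s₁ are unary function symbols (succF false = s₀,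
-- succF true = s₁), so they can be used in compositions.

data FSym : ℕ → Set where
  succF : Bool → FSym 1
  epsF  : (m : ℕ) → FSym m
  projF : (m : ℕ) → Fin m → FSym m
  compF : ∀ {k m} → FSym k → Vec (FSym m) k → FSym m
  -- recursion on notation: f(ε,x̄)=g_ε(x̄), f(s_i y,x̄)=g_i(y,f(y,x̄),x̄)
  recF  : ∀ {m} → FSym m → FSym (suc (suc m)) → FSym (suc (suc m)) → FSym (suc m)

Var : Set
Var = ℕ

-- Approximate terms: PV terms plus the constant *.
data Term : Set where
  var  : Var → Term
  eps  : Term
  star : Term
  app  : ∀ {m} → FSym m → Vec Term m → Term

S : Bool → Term → Term
S b t = app (succF b) (t ∷ [])

mutual
  size : Term → ℕ
  size (var _) = 1
  size eps = 1
  size star = 1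
  size (app f ts) = suc (sizes ts)

  sizes : ∀ {m} → Vec Term m → ℕ
  sizes [] = 0
  sizes (t ∷ ts) = size t + sizes ts

isGNum : Term → Bool
isGNum eps = true
isGNum star = true
isGNum (var _) = false
isGNum (app (succF b) (t ∷ [])) = isGNum t
isGNum (app _ _) = false

GNum : Term → Set
GNum t = isGNum t ≡ true

-- approximation  r ⪯ t  ("t approximates r")
mutual
  data _⪯_ : Term → Term → Set where
    ⪯-star : ∀ {r} → r ⪯ star
    ⪯-refl : ∀ {r} → r ⪯ r
    ⪯-app  : ∀ {m} {f : FSym m} {rs ts : Vec Term m} → rs ⪯s ts → app f rs ⪯ app f ts

  data _⪯s_ : ∀ {m} → Vec Term m → Vec Term m → Set where
    []  : [] ⪯s []
    _∷_ : ∀ {m r t} {rs ts : Vec Term m} → r ⪯ t → rs ⪯s ts → (r ∷ rs) ⪯s (t ∷ ts)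

mutual
  occurs : Var → Term → Bool
  occurs x (var y) = x ≡ᵇ y
  occurs x eps = false
  occurs x star = false
  occurs x (app f ts) = occursV x ts

  occursV : ∀ {m} → Var → Vec Term m → Bool
  occursV x [] = false
  occursV x (t ∷ ts) = occurs x t ∨ occursV x ts

mutual
  _[_/_] : Term → Term → Var → Term
  var y [ u / x ] = if x ≡ᵇ y then u else var y
  eps [ u / x ] = eps
  star [ u / x ] = star
  app f ts [ u / x ] = app f (substV ts u x)

  substV : ∀ {m} → Vec Term m → Term → Var → Vec Term m
  substV [] u x = []
  substV (t ∷ ts) u x = (t [ u / x ]) ∷ substV ts u x

-- Developments [t₁/x₁]⋯[tₙ/xₙ] as the list (x₁,t₁) ∷ ⋯ ∷ (xₙ,tₙ) ∷ [].

Dev : Set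
Dev = List (Var × Term)

IsDev : Dev → Set
IsDev ρ = Unique (map proj₁ ρ) × All (λ p → occurs (proj₁ p) (proj₂ p) ≡ false) ρ

record Stmt : Set where
  constructor ⟨_,_⟩↓_
  field
    term : Term
    env  : Dev
    val  : Term
open Stmt public

-- Argument premises (⟨tᵢ,ρ⟩↓vᵢ)_{i∈X}, X = indices with tᵢ not a g-numeral,
-- together with the convention vᵢ := tᵢ for i ∉ X.

argPrems : ∀ {m} → Vec Term m → Vec Term m → Dev → List Stmt
argPrems [] [] ρ = []
argPrems (t ∷ ts) (v ∷ vs) ρ =
  if isGNum t then argPrems ts vs ρ else ((⟨ t , ρ ⟩↓ v) ∷ argPrems ts vs ρ)

ArgVals : ∀ {m} → Vec Term m → Vec Term m → Set
ArgVals [] [] = ⊤′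
  where open import Data.Unit using () renaming (⊤ to ⊤′)
ArgVals (t ∷ ts) (v ∷ vs) = (GNum t → v ≡ t) × ArgVals ts vs

hPrems : ∀ {k m} → Vec (FSym m) k → Vec (Vec Term m) k → Vec Term k → List Stmt
hPrems [] [] [] = []
hPrems (h ∷ hs) (vs ∷ vss) (w ∷ ws) = (⟨ app h vs , [] ⟩↓ w) ∷ hPrems hs vss ws

AllApprox : ∀ {k m} → Vec Term m → Vec (Vec Term m) k → Set
AllApprox vs [] = ⊤′
  where open import Data.Unit using () renaming (⊤ to ⊤′)
AllApprox vs (vs′ ∷ vss) = vs ⪯s vs′ × AllApprox vs vss

firstPrem : Term → Dev → Term → List Stmt
firstPrem t ρ v = if isGNum t then [] else ((⟨ t , ρ ⟩↓ v) ∷ [])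

FirstVal : Term → Term → Set
FirstVal t v = GNum t → t ≡ v

sel : ∀ {A : Set} → Bool → A → A → A
sel false a b = a
sel true  a b = b

data RuleName : Set where
  rSubst rStar rEpsN rEps rEpsM rProj rComp rRecE : RuleName
  rS rSN rRecS : Bool → RuleName

data Rule : RuleName → Stmt → List Stmt → Set where
  subst : ∀ {x t v} (ρ₁ ρ₂ : Dev) →
    All (λ p → proj₁ p ≢ x) ρ₁ →
    Rule rSubst (⟨ var x , ρ₁ ++ ((x , t) ∷ ρ₂) ⟩↓ v) ((⟨ t , ρ₂ ⟩↓ v) ∷ [])
  star : ∀ {t ρ} → Rule rStar (⟨ t , ρ ⟩↓ star) []
  epsN : Rule rEpsN (⟨ eps , [] ⟩↓ eps) []
  epsR : ∀ {ρ} → ρ ≢ [] →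
    Rule rEps (⟨ eps , ρ ⟩↓ eps) ((⟨ eps , [] ⟩↓ eps) ∷ [])
  succR : ∀ {t ρ v v*} (b : Bool) → v ⪯ v* → (t ≢ v* ⊎ ρ ≢ []) →
    Rule (rS b) (⟨ S b t , ρ ⟩↓ S b v*)
      ((⟨ S b v* , [] ⟩↓ S b v*) ∷ (⟨ t , ρ ⟩↓ v) ∷ [])
  succN : ∀ {v} (b : Bool) → GNum v →
    Rule (rSN b) (⟨ S b v , [] ⟩↓ S b v) ((⟨ v , [] ⟩↓ v) ∷ [])
  epsM : ∀ {m ρ} {ts vs : Vec Term m} → ArgVals ts vs →
    Rule rEpsM (⟨ app (epsF m) ts , ρ ⟩↓ eps)
      ((⟨ eps , [] ⟩↓ eps) ∷ argPrems ts vs ρ)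
  proj : ∀ {m ρ} {ts vs : Vec Term m} (i : Fin m) {vi* : Term} →
    ArgVals ts vs → Data.Vec.lookup vs i ⪯ vi* →
    Rule rProj (⟨ app (projF m i) ts , ρ ⟩↓ vi*)
      ((⟨ vi* , [] ⟩↓ vi*) ∷ argPrems ts vs ρ)
  comp : ∀ {k m ρ z} (g : FSym k) (hs : Vec (FSym m) k)
    {ts vs : Vec Term m} (vss : Vec (Vec Term m) k) (ws ws* : Vec Term k) →
    ArgVals ts vs → AllApprox vs vss → ws ⪯s ws* →
    Rule rComp (⟨ app (compF g hs) ts , ρ ⟩↓ z)
      ((⟨ app g ws* , [] ⟩↓ z) ∷ (hPrems hs vss ws ++ argPrems ts vs ρ))
  recE : ∀ {m ρ z} (gε : FSym m) (g₀ g₁ : FSym (suc (suc m)))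
    {t : Term} {ts vs vs¹ : Vec Term m} →
    FirstVal t eps → ArgVals ts vs → vs ⪯s vs¹ →
    Rule rRecE (⟨ app (recF gε g₀ g₁) (t ∷ ts) , ρ ⟩↓ z)
      ((⟨ app gε vs¹ , [] ⟩↓ z) ∷ (firstPrem t ρ eps ++ argPrems ts vs ρ))
  recS : ∀ {m ρ z} (b : Bool) (gε : FSym m) (g₀ g₁ : FSym (suc (suc m)))
    {t v₀ v₀¹ v₀² w w¹ : Term} {ts vs vs¹ vs² : Vec Term m} →
    FirstVal t (S b v₀) → ArgVals ts vs →
    v₀ ⪯ v₀¹ → v₀ ⪯ v₀² → w ⪯ w¹ → vs ⪯s vs¹ → vs ⪯s vs² →
    Rule (rRecS b) (⟨ app (recF gε g₀ g₁) (t ∷ ts) , ρ ⟩↓ z)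
      ((⟨ app (sel b g₀ g₁) (v₀¹ ∷ w¹ ∷ vs¹) , [] ⟩↓ z)
        ∷ (firstPrem t ρ (S b v₀)
          ++ ((⟨ app (recF gε g₀ g₁) (v₀² ∷ vs²) , [] ⟩↓ w)
            ∷ argPrems ts vs ρ)))

-- Computations: finite sequences of statements, each obtained by one rule
-- from earlier entries (premises are given by their positions; DAG view).

record Node : Set where
  constructor node
  field
    stmt  : Stmt
    rule  : RuleName
    prems : List ℕ
open Node public

Comp : Set
Comp = List Node

stmtAt : Comp → ℕ → Maybe Stmt
stmtAt [] k = nothing
stmtAt (nd ∷ σ) zero = just (stmt nd)
stmtAt (nd ∷ σ) (suc k) = stmtAt σ k

premStmts : Comp → List ℕ → Maybe (List Stmt)
premStmts σ [] = just []
premStmts σ (k ∷ ks) with stmtAt σ k | premStmts σ ks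
... | just s | just ss = just (s ∷ ss)
... | _      | _       = nothing

Valid : Comp → Set
Valid σ = (i : Fin (length σ)) →
  let nd = lookup σ i in
  All (_< toℕ i) (prems nd) ×
  (Σ (List Stmt) λ ps → premStmts σ (prems nd) ≡ just ps × Rule (rule nd) (stmt nd) ps) ×
  IsDev (env (stmt nd))

nodes : Comp → ℕ
nodes = length

M : Comp → ℕ
M σ = foldr (λ nd r → size (term (stmt nd)) ⊔ r) 0 σ

IsConcl : (σ : Comp) → Fin (length σ) → Set
IsConcl σ i = All (λ nd → ¬ (toℕ i ∈ prems nd)) σ

ConclStmt : Comp → Stmt → Set
ConclStmt σ α = Σ (Fin (length σ)) λ i → IsConcl σ i × stmt (lookup σ i) ≡ α

ConclusionsAre : Comp → List Stmt → Set
ConclusionsAre σ L =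
  ((i : Fin (length σ)) → IsConcl σ i → stmt (lookup σ i) ∈ L) × All (ConclStmt σ) L

Derives : Comp → List Stmt → Set
Derives τ L = All (ConclStmt τ) L

SameDerivation : Comp → Comp → Stmt → Set
SameDerivation σ τ α =
  Σ (Fin (length σ)) λ i → Σ (Fin (length τ)) λ j →
    IsConcl σ i × IsConcl τ j ×
    stmt (lookup σ i) ≡ α × stmt (lookup τ j) ≡ α ×
    rule (lookup σ i) ≡ rule (lookup τ j) ×
    premStmts σ (prems (lookup σ i)) ≡ premStmts τ (prems (lookup τ j))

stmtsWith : ∀ {n} → Vec Term n → Dev → Vec Term n → List Stmt
stmtsWith [] ρ [] = []
stmtsWith (t ∷ ts) ρ (v ∷ vs) = (⟨ t , ρ ⟩↓ v) ∷ stmtsWith ts ρ vs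

module Submission where

-- The computation τ consists of σ followed by freshly appended nodes.  For
-- each conclusion ⟨t,[u/x]ρ⟩↓v of σ the derivation of that statement in σ is
-- translated, by recursion on t, into a derivation of ⟨t[u/x],ρ⟩↓v: every
-- rule used by σ is replayed on the substituted main term, a (Subst) step
-- for x is replaced by a copy of the node deriving its premise ⟨u,ρ⟩↓v, and
-- an argument that becomes a g-numeral after substitution drops its premise
-- (its new value is approximated by the old one, see approx-subst).
-- Translating t appends at most ‖t‖ ≤ ‖t[u/x]‖ nodes, each with a main term
-- t'[u/x] for a main term t' of σ, hence of size ≤ M(σ)·‖u‖.  Appended nodes
-- only refer to earlier appended nodes or to nodes that already are premises
-- in σ, so the conclusions ᾱ of σ stay conclusions of τ (with the same rule
-- and premises), and the last node of each translation is a conclusion of τ.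

open import Defs
open import Data.Nat using (ℕ; _+_; _*_; _≤_)
open import Data.Vec using (Vec)
open import Data.List using (List; _∷_; _++_; length)
open import Data.List.Relation.Unary.All using (All)
open import Data.Product using (Σ; _×_; _,_)

open import Data.Nat using (zero; suc; _<_; _≡ᵇ_; z≤n; s≤s; _<?_; _≤?_)
open import Data.Nat.Properties
open import Data.Bool using (true; false)
open import Data.Bool.Properties using (T-≡; not-¬)
open import Data.Fin using (Fin; toℕ)
open import Data.Fin.Properties using (toℕ<n)
open import Data.Vec using ([]; _∷_)
open import Data.List using ([]; _∷ʳ_; lookup)
open import Data.List.Properties using (length-++)
open import Data.List.Relation.Unary.All using ([]; _∷_)
import Data.List.Relation.Unary.All as All
import Data.List.Relation.Unary.All.Properties as AllP
open import Data.List.Relation.Unary.AllPairs using () renaming (_∷_ to _∷ᵘ_)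
open import Data.List.Relation.Binary.Pointwise using (Pointwise; []; _∷_)
import Data.List.Relation.Binary.Pointwise as Pointwise
open import Data.List.Membership.Propositional using (_∈_)
open import Data.List.Relation.Unary.Any using (here; there)
open import Data.Maybe using (Maybe; just; nothing)
import Data.Maybe as Maybe
open import Data.Product using (proj₁; proj₂)
open import Data.Sum using (_⊎_; inj₁; inj₂)
open import Data.Empty using (⊥-elim)
open import Function using (Equivalence; _∘_)
open import Relation.Binary.PropositionalEquality
  using (_≡_; _≢_; refl; sym; trans; cong) renaming (subst to transport)
open import Relation.Nullary using (¬_; Dec; yes; no)

module Positions where

  nodeAt : Comp → ℕ → Maybe Node
  nodeAt []       k       = nothing
  nodeAt (nd ∷ τ) zero    = just nd
  nodeAt (nd ∷ τ) (suc k) = nodeAt τ k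

  StmtAt : Comp → ℕ → Stmt → Set
  StmtAt τ k s = stmtAt τ k ≡ just s

  stmtAt-nodeAt : ∀ τ k → stmtAt τ k ≡ Maybe.map stmt (nodeAt τ k)
  stmtAt-nodeAt []       k       = refl
  stmtAt-nodeAt (nd ∷ τ) zero    = refl
  stmtAt-nodeAt (nd ∷ τ) (suc k) = stmtAt-nodeAt τ k

  nodeAt-stmt : ∀ τ k {nd} → nodeAt τ k ≡ just nd → StmtAt τ k (stmt nd)
  nodeAt-stmt τ k e rewrite stmtAt-nodeAt τ k | e = refl

  stmtAt-node : ∀ τ k {s} → StmtAt τ k s →
    Σ Node λ nd → nodeAt τ k ≡ just nd × stmt nd ≡ s
  stmtAt-node τ k e rewrite stmtAt-nodeAt τ k with nodeAt τ k | e
  ... | just nd | refl = nd , refl , refl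

  nodeAt-< : ∀ τ k {nd} → nodeAt τ k ≡ just nd → k < length τ
  nodeAt-< (_ ∷ τ) zero    _ = s≤s z≤n
  nodeAt-< (_ ∷ τ) (suc k) e = s≤s (nodeAt-< τ k e)

  stmtAt-< : ∀ τ k {s} → StmtAt τ k s → k < length τ
  stmtAt-< τ k e = nodeAt-< τ k (proj₁ (proj₂ (stmtAt-node τ k e)))

  nodeAt-lookup : ∀ τ (i : Fin (length τ)) → nodeAt τ (toℕ i) ≡ just (lookup τ i)
  nodeAt-lookup (_ ∷ τ) Fin.zero    = refl
  nodeAt-lookup (_ ∷ τ) (Fin.suc i) = nodeAt-lookup τ i

  nodeAt-index : ∀ τ k {nd} → nodeAt τ k ≡ just nd →
    Σ (Fin (length τ)) λ i → toℕ i ≡ k × lookup τ i ≡ nd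
  nodeAt-index (_ ∷ τ) zero    refl = Fin.zero , refl , refl
  nodeAt-index (_ ∷ τ) (suc k) e with nodeAt-index τ k e
  ... | i , refl , l = Fin.suc i , refl , l

  all-nodeAt : ∀ {P : Node → Set} τ →
    (∀ k nd → nodeAt τ k ≡ just nd → P nd) → All P τ
  all-nodeAt []       f = []
  all-nodeAt (nd ∷ τ) f = f zero nd refl ∷ all-nodeAt τ λ k → f (suc k)

  nodeAt-all : ∀ {P : Node → Set} τ → All P τ → ∀ k {nd} → nodeAt τ k ≡ just nd → P nd
  nodeAt-all (_ ∷ τ) (p ∷ ps) zero    refl = p
  nodeAt-all (_ ∷ τ) (p ∷ ps) (suc k) e    = nodeAt-all τ ps k e

  Premises : Comp → List ℕ → List Stmt → Set
  Premises τ = Pointwise (StmtAt τ)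

  pointwise-all : ∀ {P : ℕ → Stmt → Set} {Q : ℕ → Set} → (∀ {k s} → P k s → Q k) →
    ∀ {ks ps} → Pointwise P ks ps → All Q ks
  pointwise-all f []       = []
  pointwise-all f (p ∷ ps) = f p ∷ pointwise-all f ps

  pointwise-split : ∀ {P : ℕ → Stmt → Set} ss {ss′ ks} → Pointwise P ks (ss ++ ss′) →
    Σ (List ℕ) λ ks₁ → Σ (List ℕ) λ ks₂ → ks ≡ ks₁ ++ ks₂ × Pointwise P ks₁ ss × Pointwise P ks₂ ss′
  pointwise-split []       ps       = [] , _ , refl , [] , ps
  pointwise-split (s ∷ ss) (p ∷ ps) with pointwise-split ss ps
  ... | ks₁ , ks₂ , refl , ps₁ , ps₂ = _ ∷ ks₁ , ks₂ , refl , p ∷ ps₁ , ps₂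

  premises⇒premStmts : ∀ τ {ks ps} → Premises τ ks ps → premStmts τ ks ≡ just ps
  premises⇒premStmts τ [] = refl
  premises⇒premStmts τ {k ∷ ks} (e ∷ es) rewrite e | premises⇒premStmts τ es = refl

  premStmts⇒premises : ∀ τ ks {ps} → premStmts τ ks ≡ just ps → Premises τ ks ps
  premStmts⇒premises τ [] refl = []
  premStmts⇒premises τ (k ∷ ks) e with stmtAt τ k in e₁ | premStmts τ ks in e₂
  premStmts⇒premises τ (k ∷ ks) refl | just s | just ss = e₁ ∷ premStmts⇒premises τ ks e₂

  NodeValid : Comp → ℕ → Node → Set
  NodeValid τ k nd = All (_< k) (prems nd) ×
    (Σ (List Stmt) λ ps → premStmts τ (prems nd) ≡ just ps × Rule (rule nd) (stmt nd) ps) ×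
    IsDev (env (stmt nd))

  ValidAt : Comp → Set
  ValidAt τ = ∀ k nd → nodeAt τ k ≡ just nd → NodeValid τ k nd

  validAt⇒valid : ∀ τ → ValidAt τ → Valid τ
  validAt⇒valid τ v i = v (toℕ i) (lookup τ i) (nodeAt-lookup τ i)

  valid⇒validAt : ∀ τ → Valid τ → ValidAt τ
  valid⇒validAt τ v k nd e with nodeAt-index τ k e
  ... | i , refl , refl = v i

  M-nodeAt : ∀ τ k {nd} → nodeAt τ k ≡ just nd → size (term (stmt nd)) ≤ M τ
  M-nodeAt (_ ∷ τ) zero    refl = m≤m⊔n _ _
  M-nodeAt (_ ∷ τ) (suc k) e    = ≤-trans (M-nodeAt τ k e) (m≤n⊔m _ _)

  M-least : ∀ τ {b} → (∀ k nd → nodeAt τ k ≡ just nd → size (term (stmt nd)) ≤ b) → M τ ≤ b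
  M-least []       f = z≤n
  M-least (nd ∷ τ) f = ⊔-lub (f zero nd refl) (M-least τ λ k → f (suc k))

open Positions

-- (2) Extending a computation by appending nodes.

module Extension where

  record _⊑_ (a b : Comp) : Set where
    field
      ⊑-length : length a ≤ length b
      ⊑-agree  : ∀ k → k < length a → nodeAt b k ≡ nodeAt a k
  open _⊑_ public

  ⊑-refl : ∀ {a} → a ⊑ a
  ⊑-refl = record { ⊑-length = ≤-refl ; ⊑-agree = λ _ _ → refl }

  ⊑-trans : ∀ {a b c} → a ⊑ b → b ⊑ c → a ⊑ c
  ⊑-trans ab bc = record
    { ⊑-length = ≤-trans (⊑-length ab) (⊑-length bc)
    ; ⊑-agree  = λ k k< → trans (⊑-agree bc k (<-≤-trans k< (⊑-length ab))) (⊑-agree ab k k<)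
    }

  nodeAt-⊑ : ∀ {a b} → a ⊑ b → ∀ k {nd} → nodeAt a k ≡ just nd → nodeAt b k ≡ just nd
  nodeAt-⊑ {a} ab k e = trans (⊑-agree ab k (nodeAt-< a k e)) e

  stmtAt-⊑ : ∀ {a b} → a ⊑ b → ∀ k {s} → StmtAt a k s → StmtAt b k s
  stmtAt-⊑ {a} {b} ab k e with stmtAt-node a k e
  ... | nd , e′ , refl = nodeAt-stmt b k (nodeAt-⊑ ab k e′)

  premises-⊑ : ∀ {a b} → a ⊑ b → ∀ {ks ps} → Premises a ks ps → Premises b ks ps
  premises-⊑ ab = Pointwise.map (stmtAt-⊑ ab _)

  premStmts-⊑ : ∀ {a b} → a ⊑ b → ∀ ks {ps} → premStmts a ks ≡ just ps → premStmts b ks ≡ just ps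
  premStmts-⊑ {a} {b} ab ks e = premises⇒premStmts b (premises-⊑ ab (premStmts⇒premises a ks e))

  length-∷ʳ : ∀ τ (nd : Node) → length (τ ∷ʳ nd) ≡ suc (length τ)
  length-∷ʳ τ nd = trans (length-++ τ) (+-comm (length τ) 1)

  nodeAt-∷ʳ-old : ∀ τ (nd : Node) k → k < length τ → nodeAt (τ ∷ʳ nd) k ≡ nodeAt τ k
  nodeAt-∷ʳ-old (_ ∷ τ) nd zero    _       = refl
  nodeAt-∷ʳ-old (_ ∷ τ) nd (suc k) (s≤s k<) = nodeAt-∷ʳ-old τ nd k k<

  nodeAt-∷ʳ-new : ∀ τ (nd : Node) → nodeAt (τ ∷ʳ nd) (length τ) ≡ just nd
  nodeAt-∷ʳ-new []      nd = refl
  nodeAt-∷ʳ-new (_ ∷ τ) nd = nodeAt-∷ʳ-new τ nd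

  ⊑-∷ʳ : ∀ τ nd → τ ⊑ (τ ∷ʳ nd)
  ⊑-∷ʳ τ nd = record
    { ⊑-length = ≤-trans (n≤1+n (length τ)) (≤-reflexive (sym (length-∷ʳ τ nd)))
    ; ⊑-agree  = nodeAt-∷ʳ-old τ nd
    }

  nodeAt-∷ʳ : ∀ τ nd k {nd′} → nodeAt (τ ∷ʳ nd) k ≡ just nd′ →
    (k < length τ × nodeAt τ k ≡ just nd′) ⊎ (k ≡ length τ × nd′ ≡ nd)
  nodeAt-∷ʳ τ nd k {nd′} e with k <? length τ
  ... | yes k< = inj₁ (k< , trans (sym (nodeAt-∷ʳ-old τ nd k k<)) e)
  ... | no k≮ with m≤n⇒m<n∨m≡n (≤-pred (transport (k <_) (length-∷ʳ τ nd) (nodeAt-< (τ ∷ʳ nd) k e)))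
  ...   | inj₁ k< = ⊥-elim (k≮ k<)
  ...   | inj₂ refl with trans (sym (nodeAt-∷ʳ-new τ nd)) e
  ...     | refl = inj₂ (refl , refl)

  ∷ʳ-valid : ∀ τ nd {ps} → ValidAt τ → All (_< length τ) (prems nd) →
    Premises τ (prems nd) ps → Rule (rule nd) (stmt nd) ps → IsDev (env (stmt nd)) →
    ValidAt (τ ∷ʳ nd)
  ∷ʳ-valid τ nd v p< ps r dv k nd′ e with nodeAt-∷ʳ τ nd k e
  ... | inj₁ (k< , e′) with v k nd′ e′
  ...   | prems< , (ps′ , pe , r′) , dv′ =
          prems< , (ps′ , premStmts-⊑ (⊑-∷ʳ τ nd) (prems nd′) pe , r′) , dv′
  ∷ʳ-valid τ nd v p< ps r dv k nd′ e | inj₂ (refl , refl) =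
    p< , (_ , premises⇒premStmts (τ ∷ʳ nd) (premises-⊑ (⊑-∷ʳ τ nd) ps) , r) , dv

open Extension

module TermFacts where

  mutual
    ⪯-trans : ∀ {a b c} → a ⪯ b → b ⪯ c → a ⪯ c
    ⪯-trans p         ⪯-star    = ⪯-star
    ⪯-trans p         ⪯-refl    = p
    ⪯-trans ⪯-refl    (⪯-app q) = ⪯-app q
    ⪯-trans (⪯-app p) (⪯-app q) = ⪯-app (⪯s-trans p q)

    ⪯s-trans : ∀ {m} {a b c : Vec Term m} → a ⪯s b → b ⪯s c → a ⪯s c
    ⪯s-trans []       []       = []
    ⪯s-trans (p ∷ ps) (q ∷ qs) = ⪯-trans p q ∷ ⪯s-trans ps qs

  ⪯s-lookup : ∀ {m} {a b : Vec Term m} → a ⪯s b → ∀ i → Data.Vec.lookup a i ⪯ Data.Vec.lookup b i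
  ⪯s-lookup (p ∷ ps) Fin.zero    = p
  ⪯s-lookup (p ∷ ps) (Fin.suc i) = ⪯s-lookup ps i

  allApprox-⪯s : ∀ {k m} {a b : Vec Term m} {vss : Vec (Vec Term m) k} →
    a ⪯s b → AllApprox b vss → AllApprox a vss
  allApprox-⪯s {vss = []}      p _       = _
  allApprox-⪯s {vss = vs ∷ vss} p (q , r) = ⪯s-trans p q , allApprox-⪯s p r

  ⪯-eps : ∀ {e} → e ⪯ eps → e ≡ eps
  ⪯-eps ⪯-refl = refl

  ⪯-S : ∀ {e b v} → e ⪯ S b v → Σ Term λ v′ → e ≡ S b v′ × v′ ⪯ v
  ⪯-S ⪯-refl           = _ , refl , ⪯-refl
  ⪯-S (⪯-app (p ∷ [])) = _ , refl , p

  -- Equality of terms is decidable (needed for the side condition of (s_i)).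
  mutual
    _≟F_ : ∀ {m} (f g : FSym m) → Dec (f ≡ g)
    succF b ≟F succF c with b Data.Bool.Properties.≟ c
    ... | yes refl = yes refl
    ... | no ne    = no λ { refl → ne refl }
    succF _ ≟F epsF _        = no λ ()
    succF _ ≟F projF _ _     = no λ ()
    succF _ ≟F compF _ _     = no λ ()
    succF _ ≟F recF _ _ _    = no λ ()
    epsF _ ≟F succF _        = no λ ()
    epsF m ≟F epsF m         = yes refl
    epsF _ ≟F projF _ _      = no λ ()
    epsF _ ≟F compF _ _      = no λ ()
    epsF _ ≟F recF _ _ _     = no λ ()
    projF _ _ ≟F succF _     = no λ ()
    projF _ _ ≟F epsF _      = no λ ()
    projF m i ≟F projF m j with i Data.Fin.Properties.≟ j
    ... | yes refl = yes refl
    ... | no ne    = no λ { refl → ne refl }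
    projF _ _ ≟F compF _ _   = no λ ()
    projF _ _ ≟F recF _ _ _  = no λ ()
    compF _ _ ≟F succF _     = no λ ()
    compF _ _ ≟F epsF _      = no λ ()
    compF _ _ ≟F projF _ _   = no λ ()
    compF {k} g hs ≟F compF {k′} g′ hs′ with k Data.Nat.≟ k′
    ... | no ne = no λ { refl → ne refl }
    ... | yes refl with g ≟F g′ | hs ≟Fs hs′
    ...   | yes refl | yes refl = yes refl
    ...   | no ne    | _        = no λ { refl → ne refl }
    ...   | yes _    | no ne    = no λ { refl → ne refl }
    compF _ _ ≟F recF _ _ _  = no λ ()
    recF _ _ _ ≟F succF _    = no λ ()
    recF _ _ _ ≟F epsF _     = no λ ()
    recF _ _ _ ≟F projF _ _  = no λ ()
    recF _ _ _ ≟F compF _ _  = no λ ()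
    recF a b c ≟F recF a′ b′ c′ with a ≟F a′ | b ≟F b′ | c ≟F c′
    ... | yes refl | yes refl | yes refl = yes refl
    ... | no ne    | _        | _        = no λ { refl → ne refl }
    ... | yes _    | no ne    | _        = no λ { refl → ne refl }
    ... | yes _    | yes _    | no ne    = no λ { refl → ne refl }

    _≟Fs_ : ∀ {k m} (fs gs : Vec (FSym m) k) → Dec (fs ≡ gs)
    [] ≟Fs [] = yes refl
    (f ∷ fs) ≟Fs (g ∷ gs) with f ≟F g | fs ≟Fs gs
    ... | yes refl | yes refl = yes refl
    ... | no ne    | _        = no λ { refl → ne refl }
    ... | yes _    | no ne    = no λ { refl → ne refl }

  mutual
    _≟T_ : (a b : Term) → Dec (a ≡ b)
    var x ≟T var y with x Data.Nat.≟ y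
    ... | yes refl = yes refl
    ... | no ne    = no λ { refl → ne refl }
    var _ ≟T eps     = no λ ()
    var _ ≟T star    = no λ ()
    var _ ≟T app _ _ = no λ ()
    eps ≟T var _     = no λ ()
    eps ≟T eps       = yes refl
    eps ≟T star      = no λ ()
    eps ≟T app _ _   = no λ ()
    star ≟T var _    = no λ ()
    star ≟T eps      = no λ ()
    star ≟T star     = yes refl
    star ≟T app _ _  = no λ ()
    app _ _ ≟T var _ = no λ ()
    app _ _ ≟T eps   = no λ ()
    app _ _ ≟T star  = no λ ()
    app {m} f ts ≟T app {m′} g us with m Data.Nat.≟ m′
    ... | no ne = no λ { refl → ne refl }
    ... | yes refl with f ≟F g | ts ≟Ts us
    ...   | yes refl | yes refl = yes refl
    ...   | no ne    | _        = no λ { refl → ne refl }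
    ...   | yes _    | no ne    = no λ { refl → ne refl }

    _≟Ts_ : ∀ {m} (ts us : Vec Term m) → Dec (ts ≡ us)
    [] ≟Ts [] = yes refl
    (t ∷ ts) ≟Ts (u ∷ us) with t ≟T u | ts ≟Ts us
    ... | yes refl | yes refl = yes refl
    ... | no ne    | _        = no λ { refl → ne refl }
    ... | yes _    | no ne    = no λ { refl → ne refl }

  ≡ᵇ-refl : ∀ x → (x ≡ᵇ x) ≡ true
  ≡ᵇ-refl x = Equivalence.to T-≡ (≡⇒≡ᵇ x x refl)

  ≡ᵇ-false : ∀ x y → x ≢ y → (x ≡ᵇ y) ≡ false
  ≡ᵇ-false x y ne with x ≡ᵇ y in e
  ... | true  = ⊥-elim (ne (≡ᵇ⇒≡ x y (Equivalence.from T-≡ e)))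
  ... | false = refl

  subst-gnum : ∀ t u x → GNum t → t [ u / x ] ≡ t
  subst-gnum eps                     u x g = refl
  subst-gnum star                    u x g = refl
  subst-gnum (app (succF b) (t ∷ [])) u x g = cong (S b) (subst-gnum t u x g)

  size≥1 : ∀ t → 1 ≤ size t
  size≥1 (var _)   = s≤s z≤n
  size≥1 eps       = s≤s z≤n
  size≥1 star      = s≤s z≤n
  size≥1 (app _ _) = s≤s z≤n

  size≤1·size : ∀ u → size u ≤ 1 * size u
  size≤1·size u = ≤-reflexive (sym (*-identityˡ (size u)))

  -- ‖t‖ ≤ ‖t[u/x]‖ ≤ ‖t‖·‖u‖; an atom t becomes u or stays of size 1 ≤ ‖u‖.
  mutual
    size-subst : ∀ t u x → size (t [ u / x ]) ≤ size t * size u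
    size-subst (var y) u x with x ≡ᵇ y
    ... | true  = size≤1·size u
    ... | false = ≤-trans (size≥1 u) (size≤1·size u)
    size-subst eps        u x = ≤-trans (size≥1 u) (size≤1·size u)
    size-subst star       u x = ≤-trans (size≥1 u) (size≤1·size u)
    size-subst (app f ts) u x = +-mono-≤ (size≥1 u) (sizes-subst ts u x)

    sizes-subst : ∀ {m} (ts : Vec Term m) u x → sizes (substV ts u x) ≤ sizes ts * size u
    sizes-subst []       u x = z≤n
    sizes-subst (t ∷ ts) u x = ≤-trans (+-mono-≤ (size-subst t u x) (sizes-subst ts u x))
      (≤-reflexive (sym (*-distribʳ-+ (size u) (size t) (sizes ts))))

  mutual
    size≤size-subst : ∀ t u x → size t ≤ size (t [ u / x ])
    size≤size-subst (var y) u x with x ≡ᵇ y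
    ... | true  = size≥1 u
    ... | false = ≤-refl
    size≤size-subst eps        u x = ≤-refl
    size≤size-subst star       u x = ≤-refl
    size≤size-subst (app f ts) u x = s≤s (sizes≤sizes-subst ts u x)

    sizes≤sizes-subst : ∀ {m} (ts : Vec Term m) u x → sizes ts ≤ sizes (substV ts u x)
    sizes≤sizes-subst []       u x = z≤n
    sizes≤sizes-subst (t ∷ ts) u x = +-mono-≤ (size≤size-subst t u x) (sizes≤sizes-subst ts u x)

  argPrems-∷ : ∀ {m} t (ts : Vec Term m) v vs ρ →
    argPrems (t ∷ ts) (v ∷ vs) ρ ≡ firstPrem t ρ v ++ argPrems ts vs ρ
  argPrems-∷ t ts v vs ρ with isGNum t
  ... | true  = refl
  ... | false = refl

  argPrems-gnum : ∀ {m} t (ts : Vec Term m) v vs ρ → isGNum t ≡ true →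
    argPrems (t ∷ ts) (v ∷ vs) ρ ≡ argPrems ts vs ρ
  argPrems-gnum t ts v vs ρ g rewrite g = refl

  argPrems-nongnum : ∀ {m} t (ts : Vec Term m) v vs ρ → isGNum t ≡ false →
    argPrems (t ∷ ts) (v ∷ vs) ρ ≡ (⟨ t , ρ ⟩↓ v) ∷ argPrems ts vs ρ
  argPrems-nongnum t ts v vs ρ g rewrite g = refl

open TermFacts

-- (4) The translation.  Fixed: the computation σ, and the substitution [u/x]
-- to be pushed from the environment (x , u) ∷ ρ into the main terms.

module Translation (σ : Comp) (validσ : ValidAt σ) (u : Term) (x : Var) (ρ : Dev) where

  ρ⁺ : Dev
  ρ⁺ = (x , u) ∷ ρ

  bound : ℕ
  bound = M σ * size u

  M≤bound : M σ ≤ bound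
  M≤bound = ≤-trans (≤-reflexive (sym (*-identityʳ (M σ)))) (*-monoʳ-≤ (M σ) (size≥1 u))

  size-σ : ∀ k {s} → StmtAt σ k s → size (term s) ≤ M σ
  size-σ k e with stmtAt-node σ k e
  ... | nd , e′ , refl = M-nodeAt σ k e′

  bound-σ : ∀ k {s} → StmtAt σ k s → size (term s) ≤ bound
  bound-σ k e = ≤-trans (size-σ k e) M≤bound

  bound-subst : ∀ t k {ρ′ v} → StmtAt σ k (⟨ t , ρ′ ⟩↓ v) → size (t [ u / x ]) ≤ bound
  bound-subst t k e = ≤-trans (size-subst t u x) (*-monoˡ-≤ (size u) (size-σ k e))

  -- Position p is used as a premise by some node of σ (so it is not a conclusion).
  UsedInσ : ℕ → Set
  UsedInσ p = Σ ℕ λ q → Σ Node λ nd → nodeAt σ q ≡ just nd × p ∈ prems nd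

  usedInσ-< : ∀ {p} → UsedInσ p → p < length σ
  usedInσ-< (q , nd , e , p∈) =
    <-trans (All.lookup (proj₁ (validσ q nd e)) p∈) (nodeAt-< σ q e)

  σPremise : ℕ → Stmt → Set
  σPremise k s = StmtAt σ k s × UsedInσ k

  data Derivation (s : Stmt) : Set where
    derivation : ∀ {r ks ps} → Pointwise σPremise ks ps → Rule r s ps → IsDev (env s) →
      Derivation s

  derivation-at : ∀ k {s} → StmtAt σ k s → Derivation s
  derivation-at k e with stmtAt-node σ k e
  ... | nd , e′ , refl with validσ k nd e′
  ...   | _ , (ps , pe , r) , dv =
          derivation (used (λ p∈ → p∈) (premStmts⇒premises σ (prems nd) pe)) r dv
    where
    used : ∀ {ks ps} → (∀ {p} → p ∈ ks → p ∈ prems nd) → Premises σ ks ps → Pointwise σPremise ks ps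
    used ⊆prems []       = []
    used ⊆prems (e ∷ es) = (e , k , nd , e′ , ⊆prems (here refl)) ∷ used (λ p∈ → ⊆prems (there p∈)) es

  approx-gnum : ∀ g k {ρ′ v} → StmtAt σ k (⟨ g , ρ′ ⟩↓ v) → GNum g → g ⪯ v
  approx-gnum g k e gn with derivation-at k e
  approx-gnum g k e gn | derivation _ star _ = ⪯-star
  approx-gnum eps k e gn | derivation _ epsN _ = ⪯-refl
  approx-gnum eps k e gn | derivation _ (epsR _) _ = ⪯-refl
  approx-gnum (app (succF b) (g ∷ [])) k e gn | derivation (_ ∷ (e₂ , _) ∷ []) (succR b g⪯ _) _ =
    ⪯-app (⪯-trans (approx-gnum g _ e₂ gn) g⪯ ∷ [])
  approx-gnum (app (succF b) (g ∷ [])) k e gn | derivation _ (succN b _) _ = ⪯-refl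

  -- If t[u/x] is a g-numeral, it approximates every value computed for
  -- ⟨t,[u/x]ρ⟩ in σ; this is why an argument that becomes a g-numeral may
  -- drop its premise.
  approx-subst : ∀ t k {ρ′ v} → StmtAt σ k (⟨ t , ρ′ ⟩↓ v) → ρ′ ≡ ρ⁺ →
    GNum (t [ u / x ]) → (t [ u / x ]) ⪯ v
  approx-subst t k e eq gn with derivation-at k e
  approx-subst t k e eq gn | derivation _ star _ = ⪯-star
  approx-subst (var y) k e refl gn | derivation ((e₁ , _) ∷ []) (subst [] ρ₂ _) _
    rewrite ≡ᵇ-refl x = approx-gnum u _ e₁ gn
  approx-subst (var y) k e refl gn | derivation _ (subst (p ∷ ρ₁) ρ₂ (x≢y ∷ _)) _
    rewrite ≡ᵇ-false x y x≢y with gn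
  ... | ()
  approx-subst eps k e eq gn | derivation _ (epsR _) _ = ⪯-refl
  approx-subst (app (succF b) (t ∷ [])) k e eq gn | derivation (_ ∷ (e₂ , _) ∷ []) (succR b t⪯ _) _ =
    ⪯-app (⪯-trans (approx-subst t _ e₂ eq gn) t⪯ ∷ [])

  Harmless : ℕ → ℕ → Set
  Harmless s₀ p = UsedInσ p ⊎ s₀ ≤ p

  Fresh : ℕ → Node → Set
  Fresh s₀ nd = size (term (stmt nd)) ≤ bound × All (Harmless s₀) (prems nd)

  FreshFrom : ℕ → Comp → Set
  FreshFrom s₀ τ = ∀ k nd → s₀ ≤ k → nodeAt τ k ≡ just nd → Fresh s₀ nd

  harmless-weaken : ∀ {s₀ s₁ p} → s₀ ≤ s₁ → Harmless s₁ p → Harmless s₀ p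
  harmless-weaken le (inj₁ used) = inj₁ used
  harmless-weaken le (inj₂ s₁≤p) = inj₂ (≤-trans le s₁≤p)

  freshFrom-end : ∀ τ → FreshFrom (length τ) τ
  freshFrom-end τ k nd le e = ⊥-elim (<⇒≱ (nodeAt-< τ k e) le)

  freshFrom-trans : ∀ {s₀ τ₁ τ₂} → FreshFrom s₀ τ₁ → τ₁ ⊑ τ₂ → s₀ ≤ length τ₁ →
    FreshFrom (length τ₁) τ₂ → FreshFrom s₀ τ₂
  freshFrom-trans {s₀} {τ₁} f₁ τ₁⊑τ₂ le f₂ k nd s₀≤k e with k <? length τ₁
  ... | yes k< = f₁ k nd s₀≤k (trans (sym (⊑-agree τ₁⊑τ₂ k k<)) e)
  ... | no k≮ with f₂ k nd (≮⇒≥ k≮) e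
  ...   | small , harmless = small , All.map (harmless-weaken le) harmless

  freshFrom-∷ʳ : ∀ {s₀ τ} nd → FreshFrom s₀ τ → s₀ ≤ length τ → Fresh s₀ nd → FreshFrom s₀ (τ ∷ʳ nd)
  freshFrom-∷ʳ {s₀} {τ} nd f le fresh k nd′ s₀≤k e with nodeAt-∷ʳ τ nd k e
  ... | inj₁ (_ , e′)     = f k nd′ s₀≤k e′
  ... | inj₂ (_ , refl) = fresh

  Available : Comp → ℕ → ℕ → Stmt → Set
  Available τ s₀ k s = StmtAt τ k s × Harmless s₀ k

  available-σ : ∀ {τ s₀ k s} → σ ⊑ τ → σPremise k s → Available τ s₀ k s
  available-σ σ⊑τ (e , used) = stmtAt-⊑ σ⊑τ _ e , inj₁ used

  available-σs : ∀ {τ s₀ ks ps} → σ ⊑ τ → Pointwise σPremise ks ps → Pointwise (Available τ s₀) ks ps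
  available-σs σ⊑τ = Pointwise.map (available-σ σ⊑τ)

  available-⊑ : ∀ {τ₁ τ₂ s₁ s₀ ks ps} → τ₁ ⊑ τ₂ → s₀ ≤ s₁ →
    Pointwise (Available τ₁ s₁) ks ps → Pointwise (Available τ₂ s₀) ks ps
  available-⊑ τ₁⊑τ₂ le = Pointwise.map λ (e , h) → stmtAt-⊑ τ₁⊑τ₂ _ e , harmless-weaken le h

  record Translated (τ : Comp) (s : Stmt) (n : ℕ) : Set where
    constructor translated
    field
      τ′      : Comp
      valid   : ValidAt τ′
      extends : τ ⊑ τ′
      j       : ℕ
      last    : length τ′ ≡ suc j
      new     : length τ ≤ j
      derives : StmtAt τ′ j s
      growth  : length τ′ ≤ length τ + n
      fresh   : FreshFrom (length τ) τ′

  Translate : Stmt → ℕ → Set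
  Translate s n = ∀ τ → ValidAt τ → σ ⊑ τ → Translated τ s n

  append : ∀ τ τ′ nd {ps n} → ValidAt τ′ → τ ⊑ τ′ → FreshFrom (length τ) τ′ →
    suc (length τ′) ≤ length τ + n →
    Pointwise (Available τ′ (length τ)) (prems nd) ps → Rule (rule nd) (stmt nd) ps →
    IsDev (env (stmt nd)) → size (term (stmt nd)) ≤ bound → Translated τ (stmt nd) n
  append τ τ′ nd v τ⊑τ′ f room ps r dv small = translated
    (τ′ ∷ʳ nd)
    (∷ʳ-valid τ′ nd v (pointwise-all (λ (e , _) → stmtAt-< τ′ _ e) ps) (Pointwise.map proj₁ ps) r dv)
    (⊑-trans τ⊑τ′ (⊑-∷ʳ τ′ nd))
    (length τ′) (length-∷ʳ τ′ nd) (⊑-length τ⊑τ′)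
    (nodeAt-stmt (τ′ ∷ʳ nd) (length τ′) (nodeAt-∷ʳ-new τ′ nd))
    (transport (_≤ _) (sym (length-∷ʳ τ′ nd)) room)
    (freshFrom-∷ʳ {τ = τ′} nd f (⊑-length τ⊑τ′) (small , pointwise-all proj₂ ps))

  one-node : ∀ l n → 1 ≤ n → suc l ≤ l + n
  one-node l n n≥1 = ≤-trans (≤-reflexive (+-comm 1 l)) (+-monoʳ-≤ l n≥1)

  one-more-node : ∀ {l l₁ c n} → l₁ ≤ l + c → suc c ≤ n → suc l₁ ≤ l + n
  one-more-node {l} {l₁} {c} le c<n =
    ≤-trans (s≤s le) (≤-trans (≤-reflexive (sym (+-suc l c))) (+-monoʳ-≤ l c<n))

  budget-+ : ∀ l a {b l₁ l₂} → l₁ ≤ l + a → l₂ ≤ l₁ + b → l₂ ≤ l + (a + b)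
  budget-+ l a {b} le₁ le₂ =
    ≤-trans le₂ (≤-trans (+-monoˡ-≤ b le₁) (≤-reflexive (+-assoc l a b)))

  append-now : ∀ τ nd {ps n} → ValidAt τ → 1 ≤ n →
    Pointwise (Available τ (length τ)) (prems nd) ps → Rule (rule nd) (stmt nd) ps →
    IsDev (env (stmt nd)) → size (term (stmt nd)) ≤ bound → Translated τ (stmt nd) n
  append-now τ nd v n≥1 = append τ τ nd v ⊑-refl (freshFrom-end τ) (one-node _ _ n≥1)

  copy : ∀ k {s n} → StmtAt σ k s → 1 ≤ n → Translate s n
  copy k {s} e n≥1 τ v σ⊑τ with derivation-at k e
  ... | derivation {r} {ks} ps rl dv =
    append-now τ (node s r ks) v n≥1 (available-σs σ⊑τ ps) rl dv (bound-σ k e)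

  -- Whether a development is empty decides between (ε) and (εn), and the side
  -- condition of (s_i).
  is-[] : (r : Dev) → Dec (r ≡ [])
  is-[] []      = yes refl
  is-[] (_ ∷ _) = no λ ()

  record ArgsTranslated (τ : Comp) {m} (ts vs : Vec Term m) : Set where
    constructor args
    field
      τ′        : Comp
      valid     : ValidAt τ′
      extends   : τ ⊑ τ′
      growth    : length τ′ ≤ length τ + sizes ts
      fresh     : FreshFrom (length τ) τ′
      vs′       : Vec Term m
      vals      : ArgVals (substV ts u x) vs′
      approx    : vs′ ⪯s vs
      positions : List ℕ
      premises  : Pointwise (Available τ′ (length τ)) positions (argPrems (substV ts u x) vs′ ρ)

  TranslateArgs : ∀ {m} → Vec Term m → Vec Term m → Set
  TranslateArgs ts vs = ∀ τ → ValidAt τ → σ ⊑ τ → ArgsTranslated τ ts vs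

  ArgsTranslator : ∀ {m} → Vec Term m → Vec Term m → Set
  ArgsTranslator ts vs = ∀ {ks} → Pointwise σPremise ks (argPrems ts vs ρ⁺) → TranslateArgs ts vs

  -- Each rule used by σ is
  -- replayed on the substituted main term, given translations of those
  -- premises that mention the substituted terms; all other premises are the
  -- nodes of σ.
  module Build (dev : IsDev ρ) where

    star-step : ∀ t k {ρ′ v} → StmtAt σ k (⟨ t , ρ′ ⟩↓ v) →
      Translate (⟨ t [ u / x ] , ρ ⟩↓ star) (size t)
    star-step t k e τ v _ = append-now τ (node _ rStar []) v (size≥1 t) [] star dev (bound-subst t k e)

    -- (Subst) for a variable y ≢ x: the first substitution [u/x] is skipped.
    var-step : ∀ y {t₀ v} ρ₁ ρ₂ {k₁} → x ≢ y → All (λ q → proj₁ q ≢ y) ρ₁ →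
      σPremise k₁ (⟨ t₀ , ρ₂ ⟩↓ v) → ρ ≡ ρ₁ ++ (y , t₀) ∷ ρ₂ → 1 ≤ bound →
      Translate (⟨ var y [ u / x ] , ρ ⟩↓ v) 1
    var-step y ρ₁ ρ₂ x≢y ρ₁≢y σp refl small τ v σ⊑τ rewrite ≡ᵇ-false x y x≢y =
      append-now τ (node _ rSubst (_ ∷ [])) v ≤-refl (available-σ σ⊑τ σp ∷ [])
        (subst ρ₁ ρ₂ ρ₁≢y) dev small

    -- (ε) is replayed, or becomes the axiom (εn) when ρ is empty.
    eps-step : ∀ {k₁} → σPremise k₁ (⟨ eps , [] ⟩↓ eps) → 1 ≤ bound →
      Translate (⟨ eps , ρ ⟩↓ eps) 1
    eps-step σp small τ v σ⊑τ with is-[] ρ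
    ... | yes refl = append-now τ (node _ rEpsN []) v ≤-refl [] epsN dev small
    ... | no ρ≢[] = append-now τ (node _ rEps (_ ∷ [])) v ≤-refl (available-σ σ⊑τ σp ∷ [])
                      (epsR ρ≢[]) dev small

    succ-new : ∀ b t {k₁ v v*} → σPremise k₁ (⟨ S b v* , [] ⟩↓ S b v*) →
      Translate (⟨ t [ u / x ] , ρ ⟩↓ v) (size t) → v ⪯ v* →
      ((t [ u / x ]) ≢ v* ⊎ ρ ≢ []) → size (S b (t [ u / x ])) ≤ bound →
      Translate (⟨ S b (t [ u / x ]) , ρ ⟩↓ S b v*) (size (S b t))
    succ-new b t σp translate-t v⪯ side small τ vτ σ⊑τ with translate-t τ vτ σ⊑τ
    ... | translated τ₁ v₁ τ⊑τ₁ j₁ _ new₁ at₁ growth₁ fresh₁ =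
      append τ τ₁ (node _ (rS b) (_ ∷ j₁ ∷ [])) v₁ τ⊑τ₁ fresh₁
        (one-more-node growth₁ (s≤s (m≤m+n _ 0)))
        (available-σ (⊑-trans σ⊑τ τ⊑τ₁) σp ∷ (at₁ , inj₂ new₁) ∷ []) (succR b v⪯ side) dev small

    -- (s_i): if ρ = () and t[u/x] is the approximation v*, the side condition
    -- of (s_i) fails; the statement then is the first premise, which is copied.
    succ-step : ∀ b t {k₁ v v*} → σPremise k₁ (⟨ S b v* , [] ⟩↓ S b v*) →
      Translate (⟨ t [ u / x ] , ρ ⟩↓ v) (size t) → v ⪯ v* →
      size (S b (t [ u / x ])) ≤ bound →
      Translate (⟨ S b (t [ u / x ]) , ρ ⟩↓ S b v*) (size (S b t))
    succ-step b t {v* = v*} σp translate-t v⪯ small with is-[] ρ | (t [ u / x ]) ≟T v*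
    ... | yes refl | yes refl = copy _ (proj₁ σp) (s≤s z≤n)
    ... | yes _    | no t≢v*  = succ-new b t σp translate-t v⪯ (inj₁ t≢v*) small
    ... | no ρ≢[]  | _        = succ-new b t σp translate-t v⪯ (inj₂ ρ≢[]) small

    epsM-step : ∀ {m} (ts : Vec Term m) {vs k₁ ks} → ArgsTranslator ts vs →
      σPremise k₁ (⟨ eps , [] ⟩↓ eps) → Pointwise σPremise ks (argPrems ts vs ρ⁺) →
      size (app (epsF m) (substV ts u x)) ≤ bound →
      Translate (⟨ app (epsF m) (substV ts u x) , ρ ⟩↓ eps) (size (app (epsF m) ts))
    epsM-step ts translate-ts σp pws small τ vτ σ⊑τ with translate-ts pws τ vτ σ⊑τ
    ... | args τ₁ v₁ τ⊑τ₁ growth₁ fresh₁ vs′ vals′ _ ks′ pws′ =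
      append τ τ₁ (node _ rEpsM (_ ∷ ks′)) v₁ τ⊑τ₁ fresh₁ (one-more-node growth₁ ≤-refl)
        (available-σ (⊑-trans σ⊑τ τ⊑τ₁) σp ∷ pws′) (epsM vals′) dev small

    -- (proj^i_m): the new i-th value approximates the old one.
    proj-step : ∀ {m} (i : Fin m) (ts : Vec Term m) {vs vi* k₁ ks} → ArgsTranslator ts vs →
      Data.Vec.lookup vs i ⪯ vi* → σPremise k₁ (⟨ vi* , [] ⟩↓ vi*) →
      Pointwise σPremise ks (argPrems ts vs ρ⁺) →
      size (app (projF m i) (substV ts u x)) ≤ bound →
      Translate (⟨ app (projF m i) (substV ts u x) , ρ ⟩↓ vi*) (size (app (projF m i) ts))
    proj-step i ts translate-ts vi⪯ σp pws small τ vτ σ⊑τ with translate-ts pws τ vτ σ⊑τ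
    ... | args τ₁ v₁ τ⊑τ₁ growth₁ fresh₁ vs′ vals′ approx′ ks′ pws′ =
      append τ τ₁ (node _ rProj (_ ∷ ks′)) v₁ τ⊑τ₁ fresh₁ (one-more-node growth₁ ≤-refl)
        (available-σ (⊑-trans σ⊑τ τ⊑τ₁) σp ∷ pws′)
        (proj i vals′ (⪯-trans (⪯s-lookup approx′ i) vi⪯)) dev small

    -- (comp): the premises for g and the hʲ are kept from σ.
    comp-step : ∀ {k m z} (g : FSym k) (hs : Vec (FSym m) k) (ts : Vec Term m) {vs}
      (vss : Vec (Vec Term m) k) (ws ws* : Vec Term k) {k₁ ks} →
      ArgsTranslator ts vs → AllApprox vs vss → ws ⪯s ws* →
      σPremise k₁ (⟨ app g ws* , [] ⟩↓ z) →
      Pointwise σPremise ks (hPrems hs vss ws ++ argPrems ts vs ρ⁺) →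
      size (app (compF g hs) (substV ts u x)) ≤ bound →
      Translate (⟨ app (compF g hs) (substV ts u x) , ρ ⟩↓ z) (size (app (compF g hs) ts))
    comp-step g hs ts vss ws ws* translate-ts aa ws⪯ σp pws small τ vτ σ⊑τ
      with pointwise-split (hPrems hs vss ws) pws
    ... | kh , ka , refl , pwh , pwa with translate-ts pwa τ vτ σ⊑τ
    ...   | args τ₁ v₁ τ⊑τ₁ growth₁ fresh₁ vs′ vals′ approx′ ks′ pws′ =
      append τ τ₁ (node _ rComp (_ ∷ (kh ++ ks′))) v₁ τ⊑τ₁ fresh₁ (one-more-node growth₁ ≤-refl)
        (available-σ σ⊑τ₁ σp ∷ Pointwise.++⁺ (available-σs σ⊑τ₁ pwh) pws′)
        (comp g hs vss ws ws* vals′ (allApprox-⪯s approx′ aa) ws⪯) dev small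
      where σ⊑τ₁ = ⊑-trans σ⊑τ τ⊑τ₁

    -- (rec-ε): the recursion argument is translated together with the other
    -- arguments; its new value still is ε.
    recE-step : ∀ {m z} (gε : FSym m) (g₀ g₁ : FSym (suc (suc m))) t (ts : Vec Term m)
      {vs vs¹ k₁ ks} → ArgsTranslator (t ∷ ts) (eps ∷ vs) → vs ⪯s vs¹ →
      σPremise k₁ (⟨ app gε vs¹ , [] ⟩↓ z) →
      Pointwise σPremise ks (firstPrem t ρ⁺ eps ++ argPrems ts vs ρ⁺) →
      size (app (recF gε g₀ g₁) (substV (t ∷ ts) u x)) ≤ bound →
      Translate (⟨ app (recF gε g₀ g₁) (substV (t ∷ ts) u x) , ρ ⟩↓ z)
        (size (app (recF gε g₀ g₁) (t ∷ ts)))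
    recE-step gε g₀ g₁ t ts {vs} translate-ts vs⪯ σp pws small τ vτ σ⊑τ
      with translate-ts (transport (Pointwise σPremise _) (sym (argPrems-∷ t ts eps vs ρ⁺)) pws) τ vτ σ⊑τ
    ... | args τ₁ v₁ τ⊑τ₁ growth₁ fresh₁ (e′ ∷ vs′) (first′ , vals′) (e′⪯ ∷ approx′) ks′ pws′
      with ⪯-eps e′⪯
    ... | refl =
      append τ τ₁ (node _ rRecE (_ ∷ ks′)) v₁ τ⊑τ₁ fresh₁ (one-more-node growth₁ ≤-refl)
        (available-σ (⊑-trans σ⊑τ τ⊑τ₁) σp ∷
          transport (Pointwise (Available τ₁ (length τ)) ks′)
            (argPrems-∷ (t [ u / x ]) (substV ts u x) eps vs′ ρ) pws′)
        (recE gε g₀ g₁ (λ g → sym (first′ g)) vals′ (⪯s-trans approx′ vs⪯)) dev small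

    -- (rec-s_i): as (rec-ε); the new value of the recursion argument is
    -- s_i v₀′ with v₀′ approximating v₀, and the recursive premise is kept.
    recS-step : ∀ {m z} b (gε : FSym m) (g₀ g₁ : FSym (suc (suc m))) t (ts : Vec Term m)
      {v₀ v₀¹ v₀² w w¹ vs vs¹ vs² k₁ ks} → ArgsTranslator (t ∷ ts) (S b v₀ ∷ vs) →
      v₀ ⪯ v₀¹ → v₀ ⪯ v₀² → w ⪯ w¹ → vs ⪯s vs¹ → vs ⪯s vs² →
      σPremise k₁ (⟨ app (sel b g₀ g₁) (v₀¹ ∷ w¹ ∷ vs¹) , [] ⟩↓ z) →
      Pointwise σPremise ks (firstPrem t ρ⁺ (S b v₀)
        ++ ((⟨ app (recF gε g₀ g₁) (v₀² ∷ vs²) , [] ⟩↓ w) ∷ argPrems ts vs ρ⁺)) →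
      size (app (recF gε g₀ g₁) (substV (t ∷ ts) u x)) ≤ bound →
      Translate (⟨ app (recF gε g₀ g₁) (substV (t ∷ ts) u x) , ρ ⟩↓ z)
        (size (app (recF gε g₀ g₁) (t ∷ ts)))
    recS-step b gε g₀ g₁ t ts {v₀} {vs = vs} translate-ts v₀⪯¹ v₀⪯² w⪯ vs⪯¹ vs⪯² σp pws small τ vτ σ⊑τ
      with pointwise-split (firstPrem t ρ⁺ (S b v₀)) pws
    ... | kf , _ , refl , pwf , (σpʳ ∷ pwa)
      with translate-ts (transport (Pointwise σPremise _) (sym (argPrems-∷ t ts (S b v₀) vs ρ⁺))
                          (Pointwise.++⁺ pwf pwa)) τ vτ σ⊑τ
    ... | args τ₁ v₁ τ⊑τ₁ growth₁ fresh₁ (e′ ∷ vs′) (first′ , vals′) (e′⪯ ∷ approx′) ks′ pws′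
      with ⪯-S e′⪯
    ... | v₀′ , refl , v₀′⪯
      with pointwise-split (firstPrem (t [ u / x ]) ρ (S b v₀′))
             (transport (Pointwise (Available τ₁ (length τ)) ks′)
               (argPrems-∷ (t [ u / x ]) (substV ts u x) (S b v₀′) vs′ ρ) pws′)
    ... | kf′ , ka′ , refl , pwf′ , pwa′ =
      append τ τ₁ (node _ (rRecS b) (_ ∷ (kf′ ++ (_ ∷ ka′)))) v₁ τ⊑τ₁ fresh₁
        (one-more-node growth₁ ≤-refl)
        (available-σ σ⊑τ₁ σp ∷ Pointwise.++⁺ pwf′ (available-σ σ⊑τ₁ σpʳ ∷ pwa′))
        (recS b gε g₀ g₁ (λ g → sym (first′ g)) vals′ (⪯-trans v₀′⪯ v₀⪯¹) (⪯-trans v₀′⪯ v₀⪯²)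
          w⪯ (⪯s-trans approx′ vs⪯¹) (⪯s-trans approx′ vs⪯²)) dev small
      where σ⊑τ₁ = ⊑-trans σ⊑τ τ⊑τ₁

    mutual
      translate : ∀ t {ρ′ v} k → StmtAt σ k (⟨ t , ρ′ ⟩↓ v) → ρ′ ≡ ρ⁺ →
        Translate (⟨ t [ u / x ] , ρ ⟩↓ v) (size t)
      translate t k e eq with derivation-at k e
      ... | derivation _ star _ = star-step t k e
      translate (var y) k e refl | derivation ((e₁ , _) ∷ []) (subst [] ρ₂ _) _
        rewrite ≡ᵇ-refl x = copy _ e₁ ≤-refl
      translate (var y) k e eq | derivation (σp ∷ []) (subst (p ∷ ρ₁) ρ₂ (x≢y ∷ ρ₁≢y)) _ with eq
      ... | refl = var-step y ρ₁ ρ₂ x≢y ρ₁≢y σp refl (bound-σ k e)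
      translate eps k e refl | derivation (σp ∷ []) (epsR _) _ = eps-step σp (bound-σ k e)
      translate (app (succF b) (t ∷ [])) k e refl | derivation (σp ∷ (e₂ , _) ∷ []) (succR b v⪯ _) _ =
        succ-step b t σp (translate t _ e₂ refl) v⪯ (bound-subst _ k e)
      translate (app (epsF m) ts) k e refl | derivation (σp ∷ pws) (epsM vals) _ =
        epsM-step ts (translate-args ts _ vals) σp pws (bound-subst _ k e)
      translate (app (projF m i) ts) k e refl | derivation (σp ∷ pws) (proj i vals vi⪯) _ =
        proj-step i ts (translate-args ts _ vals) vi⪯ σp pws (bound-subst _ k e)
      translate (app (compF g hs) ts) k e refl
        | derivation (σp ∷ pws) (comp g hs vss ws ws* vals aa ws⪯) _ =
        comp-step g hs ts vss ws ws* (translate-args ts _ vals) aa ws⪯ σp pws (bound-subst _ k e)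
      translate (app (recF gε g₀ g₁) ts⁺@(t ∷ ts)) k e refl
        | derivation (σp ∷ pws) (recE gε g₀ g₁ first vals vs⪯) _ =
        recE-step gε g₀ g₁ t ts (translate-args ts⁺ _ ((λ g → sym (first g)) , vals)) vs⪯ σp pws
          (bound-subst _ k e)
      translate (app (recF gε g₀ g₁) ts⁺@(t ∷ ts)) k e refl
        | derivation (σp ∷ pws) (recS b gε g₀ g₁ first vals v₀⪯¹ v₀⪯² w⪯ vs⪯¹ vs⪯²) _ =
        recS-step b gε g₀ g₁ t ts (translate-args ts⁺ _ ((λ g → sym (first g)) , vals))
          v₀⪯¹ v₀⪯² w⪯ vs⪯¹ vs⪯² σp pws (bound-subst _ k e)

      -- A g-numeral argument has no premise;
      -- one that becomes a g-numeral by substitution drops its premise (its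
      -- value approximates the old one); any other one is translated.
      translate-args : ∀ {m} (ts vs : Vec Term m) → ArgVals ts vs → ArgsTranslator ts vs
      translate-args [] [] _ [] τ v _ =
        args τ v ⊑-refl (≤-reflexive (sym (+-identityʳ _))) (freshFrom-end τ) [] _ [] [] []
      translate-args (t ∷ ts) (v ∷ vs) (val , vals) pws τ vτ σ⊑τ with isGNum t in g
      ... | true with translate-args ts vs vals pws τ vτ σ⊑τ
      ...   | args τ₁ v₁ τ⊑τ₁ growth₁ fresh₁ vs′ vals′ approx′ ks′ pws′ =
        args τ₁ v₁ τ⊑τ₁ (≤-trans growth₁ (+-monoʳ-≤ (length τ) (m≤n+m (sizes ts) (size t)))) fresh₁
          (v ∷ vs′) ((λ _ → trans (val refl) (sym (subst-gnum t u x g))) , vals′) (⪯-refl ∷ approx′) ks′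
          (transport (Pointwise (Available τ₁ (length τ)) ks′)
            (sym (argPrems-gnum (t [ u / x ]) (substV ts u x) v vs′ ρ
                   (trans (cong isGNum (subst-gnum t u x g)) g))) pws′)
      translate-args (t ∷ ts) (v ∷ vs) (val , vals) ((e₁ , _) ∷ pws) τ vτ σ⊑τ | false
        with isGNum (t [ u / x ]) in g′
      ... | true with translate-args ts vs vals pws τ vτ σ⊑τ
      ...   | args τ₁ v₁ τ⊑τ₁ growth₁ fresh₁ vs′ vals′ approx′ ks′ pws′ =
        args τ₁ v₁ τ⊑τ₁ (≤-trans growth₁ (+-monoʳ-≤ (length τ) (m≤n+m (sizes ts) (size t)))) fresh₁
          ((t [ u / x ]) ∷ vs′) ((λ _ → refl) , vals′) (approx-subst t _ e₁ refl g′ ∷ approx′) ks′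
          (transport (Pointwise (Available τ₁ (length τ)) ks′)
            (sym (argPrems-gnum (t [ u / x ]) (substV ts u x) (t [ u / x ]) vs′ ρ g′)) pws′)
      translate-args (t ∷ ts) (v ∷ vs) (val , vals) ((e₁ , _) ∷ pws) τ vτ σ⊑τ | false | false
        with translate t _ e₁ refl τ vτ σ⊑τ
      ... | translated τ₁ v₁ τ⊑τ₁ j₁ _ new₁ at₁ growth₁ fresh₁
        with translate-args ts vs vals pws τ₁ v₁ (⊑-trans σ⊑τ τ⊑τ₁)
      ... | args τ₂ v₂ τ₁⊑τ₂ growth₂ fresh₂ vs′ vals′ approx′ ks′ pws′ =
        args τ₂ v₂ (⊑-trans τ⊑τ₁ τ₁⊑τ₂)
          (budget-+ (length τ) (size t) growth₁ growth₂)
          (freshFrom-trans fresh₁ τ₁⊑τ₂ (⊑-length τ⊑τ₁) fresh₂)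
          (v ∷ vs′) ((λ gn → ⊥-elim (not-¬ g′ gn)) , vals′) (⪯-refl ∷ approx′) (j₁ ∷ ks′)
          (transport (Pointwise (Available τ₂ (length τ)) (j₁ ∷ ks′))
            (sym (argPrems-nongnum (t [ u / x ]) (substV ts u x) v vs′ ρ g′))
            ((stmtAt-⊑ τ₁⊑τ₂ _ at₁ , inj₂ new₁) ∷ available-⊑ (⊑-refl {τ₂}) (⊑-length τ⊑τ₁) pws′))

  -- A statement derived at position j ≥ |σ| of τ such that all nodes after j
  -- are fresh from j + 1; no node refers to j, so it is a conclusion of τ.
  Top : Comp → Stmt → Set
  Top τ s = Σ ℕ λ j → StmtAt τ j s × length σ ≤ j × FreshFrom (suc j) τ

  top-⊑ : ∀ {τ₁ τ₂ s} → τ₁ ⊑ τ₂ → FreshFrom (length τ₁) τ₂ → Top τ₁ s → Top τ₂ s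
  top-⊑ {τ₁} τ₁⊑τ₂ fresh (j , at , σ≤j , freshʲ) =
    j , stmtAt-⊑ τ₁⊑τ₂ j at , σ≤j , freshFrom-trans freshʲ τ₁⊑τ₂ (stmtAt-< τ₁ j at) fresh

  record AllTranslated (τ : Comp) {n} (ts vs : Vec Term n) : Set where
    constructor all-translated
    field
      τ′      : Comp
      valid   : ValidAt τ′
      extends : τ ⊑ τ′
      fresh   : FreshFrom (length τ) τ′
      growth  : length τ′ ≤ length τ + sizes ts
      tops    : All (Top τ′) (stmtsWith (substV ts u x) ρ vs)

  tail-dev : IsDev ρ⁺ → IsDev ρ
  tail-dev (_ ∷ᵘ unique , _ ∷ no-cycle) = unique , no-cycle

  conclusion-at : ∀ {s} → ConclStmt σ s → Σ ℕ λ k → StmtAt σ k s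
  conclusion-at (i , _ , refl) = toℕ i , nodeAt-stmt σ (toℕ i) (nodeAt-lookup σ i)

  translate-all : ∀ {n} (ts vs : Vec Term n) → All (ConclStmt σ) (stmtsWith ts ρ⁺ vs) →
    ∀ τ → ValidAt τ → σ ⊑ τ → AllTranslated τ ts vs
  translate-all [] [] [] τ v _ =
    all-translated τ v ⊑-refl (freshFrom-end τ) (≤-reflexive (sym (+-identityʳ _))) []
  translate-all (t ∷ ts) (v ∷ vs) (c ∷ cs) τ vτ σ⊑τ with conclusion-at c
  ... | k , e with derivation-at k e
  ... | derivation _ _ dv with Build.translate (tail-dev dv) t k e refl τ vτ σ⊑τ
  ... | translated τ₁ v₁ τ⊑τ₁ j₁ last₁ new₁ at₁ growth₁ fresh₁
    with translate-all ts vs cs τ₁ v₁ (⊑-trans σ⊑τ τ⊑τ₁)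
  ... | all-translated τ₂ v₂ τ₁⊑τ₂ fresh₂ growth₂ tops₂ =
    all-translated τ₂ v₂ (⊑-trans τ⊑τ₁ τ₁⊑τ₂) (freshFrom-trans fresh₁ τ₁⊑τ₂ (⊑-length τ⊑τ₁) fresh₂)
      (budget-+ (length τ) (size t) growth₁ growth₂)
      (top-⊑ τ₁⊑τ₂ fresh₂ (j₁ , at₁ , ≤-trans (⊑-length σ⊑τ) new₁ , freshʲ) ∷ tops₂)
    where
    freshʲ : FreshFrom (suc j₁) τ₁
    freshʲ = transport (λ l → FreshFrom l τ₁) last₁ (freshFrom-end τ₁)

  -- A top statement is a conclusion: earlier nodes cannot refer to position
  -- j, later ones only refer to σ's premises (positions < |σ| ≤ j) or beyond j.
  top-conclusion : ∀ τ → ValidAt τ → ∀ {s} → Top τ s → ConclStmt τ s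
  top-conclusion τ vτ (j , at , σ≤j , fresh) with stmtAt-node τ j at
  ... | nd , e , refl with nodeAt-index τ j e
  ... | i , refl , lk = i , all-nodeAt τ unused , cong stmt lk
    where
    unused : ∀ q nd′ → nodeAt τ q ≡ just nd′ → ¬ (toℕ i ∈ prems nd′)
    unused q nd′ e′ i∈ with q ≤? toℕ i
    ... | yes q≤i = <⇒≱ (All.lookup (proj₁ (vτ q nd′ e′)) i∈) q≤i
    ... | no q≰i with All.lookup (proj₂ (fresh q nd′ (≰⇒> q≰i) e′)) i∈
    ...   | inj₁ used = <⇒≱ (usedInσ-< used) σ≤j
    ...   | inj₂ i<i  = <⇒≱ i<i ≤-refl

  same-derivation : ∀ τ → σ ⊑ τ → FreshFrom (length σ) τ → ∀ {α} → ConclStmt σ α →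
    SameDerivation σ τ α
  same-derivation τ σ⊑τ fresh (i , concl , refl)
    with nodeAt-index τ (toℕ i) (nodeAt-⊑ σ⊑τ (toℕ i) (nodeAt-lookup σ i))
  ... | i′ , i′≡i , lk =
    i , i′ , concl , all-nodeAt τ (λ q nd′ e i′∈ → unused q nd′ e (transport (_∈ prems nd′) i′≡i i′∈)) ,
    refl , cong stmt lk , cong rule (sym lk) , same-premises
    where
    unused : ∀ q nd′ → nodeAt τ q ≡ just nd′ → ¬ (toℕ i ∈ prems nd′)
    unused q nd′ e i∈ with q <? length σ
    ... | yes q< = nodeAt-all σ concl q (trans (sym (⊑-agree σ⊑τ q q<)) e) i∈
    ... | no q≮ with All.lookup (proj₂ (fresh q nd′ (≮⇒≥ q≮) e)) i∈
    ...   | inj₁ (q′ , nd″ , e″ , i∈″) = nodeAt-all σ concl q′ e″ i∈″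
    ...   | inj₂ σ≤i = <⇒≱ (toℕ<n i) σ≤i

    same-premises : premStmts σ (prems (lookup σ i)) ≡ premStmts τ (prems (lookup τ i′))
    same-premises with validσ (toℕ i) (lookup σ i) (nodeAt-lookup σ i)
    ... | _ , (_ , pe , _) , _ =
      trans pe (sym (trans (cong (λ nd → premStmts τ (prems nd)) lk)
                             (premStmts-⊑ σ⊑τ (prems (lookup σ i)) pe)))

  same-derivation⇒conclusion : ∀ {τ α} → SameDerivation σ τ α → ConclStmt τ α
  same-derivation⇒conclusion (_ , j , _ , concl , _ , at , _) = j , concl , at

  M-bound : ∀ τ → σ ⊑ τ → FreshFrom (length σ) τ → M τ ≤ bound
  M-bound τ σ⊑τ fresh = M-least τ small
    where
    small : ∀ q nd → nodeAt τ q ≡ just nd → size (term (stmt nd)) ≤ bound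
    small q nd e with q <? length σ
    ... | yes q< = ≤-trans (M-nodeAt σ q (trans (sym (⊑-agree σ⊑τ q q<)) e)) M≤bound
    ... | no q≮  = proj₁ (fresh q nd (≮⇒≥ q≮) e)

-- (5) The theorem.  τ is σ followed by the translations of the conclusions
-- ⟨tᵢ,[u/x]ρ⟩↓vᵢ.

lemma14 : (U V : ℕ) {n : ℕ} (ts vs : Vec Term n) (u : Term) (x : Var)
    (ρ : Dev) (αs : List Stmt) (σ : Comp) →
    Valid σ →
    ConclusionsAre σ (stmtsWith ts ((x , u) ∷ ρ) vs ++ αs) →
    nodes σ + sizes (substV ts u x) ≤ U →
    M σ ≤ V →
    Σ Comp λ τ →
      Valid τ ×
      Derives τ (stmtsWith (substV ts u x) ρ vs ++ αs) ×
      nodes τ ≤ nodes σ + sizes (substV ts u x) ×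
      M τ ≤ M σ * size u ×
      All (SameDerivation σ τ) αs
lemma14 _ _ ts vs u x ρ αs σ valid (_ , conclusions) _ _ =
  τ , validAt⇒valid τ τ-valid ,
  AllP.++⁺ (All.map (top-conclusion τ τ-valid) tops)
           (All.map (same-derivation⇒conclusion ∘ kept) concl-αs) ,
  ≤-trans growth (+-monoʳ-≤ (length σ) (sizes≤sizes-subst ts u x)) ,
  M-bound τ σ⊑τ fresh ,
  All.map kept concl-αs
  where
  σ-valid : ValidAt σ
  σ-valid = valid⇒validAt σ valid
  open Translation σ σ-valid u x ρ
  concl-ts : All (ConclStmt σ) (stmtsWith ts ρ⁺ vs)
  concl-ts = proj₁ (AllP.++⁻ (stmtsWith ts ρ⁺ vs) conclusions)
  concl-αs : All (ConclStmt σ) αs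
  concl-αs = proj₂ (AllP.++⁻ (stmtsWith ts ρ⁺ vs) conclusions)
  open AllTranslated (translate-all ts vs concl-ts σ σ-valid ⊑-refl)
    renaming (τ′ to τ; valid to τ-valid; extends to σ⊑τ)
  kept : ∀ {α} → ConclStmt σ α → SameDerivation σ τ α
  kept = same-derivation τ σ⊑τ fresh
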